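{- Let $\varphi$ be a property of finite subsets of $\omega$. If there exists no infinite $\varphi$-sequence, then there is a number $z$ such that $\neg\varphi(F)$ holds for all finite sets $F > z$.
   Context: For sets $X,Y\subseteq\omega$, $X<Y$ means $X$ is finite and $\max X<\min Y$; for a number $z$, $F>z$ means $\min F>z$. $Inc(\omega)$ is the set of all finite strictly increasing sequences of natural numbers. For a tree $T\subseteq\omega^{<\omega}$, $\operatorname{ran}(T)=\bigcup_{\alpha\in T}\operatorname{ran}(\alpha)$, and for trees $T,U$, $T<U$ means $\operatorname{ran}(T)<\operatorname{ran}(U)$. A $\varphi$-tree is a finite subtree $T$ of $Inc(\omega)$ of bounded width such that for every terminal node $\alpha\in T$, $\varphi(F)$ holds for some finite $F\subseteq\operatorname{ran}(\alpha)$. A $\varphi$-sequence is a finite or infinite sequence $T_0<T_1<\cdots$ of $\varphi$-trees. -}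

module Defs where

open import Data.Nat using (ℕ; suc; _<_)
open import Data.List using (List; []; _∷ʳ_)
open import Data.List.Membership.Propositional using (_∈_)
open import Data.List.Relation.Binary.Subset.Propositional using (_⊆_)
open import Data.List.Relation.Unary.All using (All)
open import Data.List.Relation.Unary.Linked using (Linked)
open import Data.Product using (Σ; _×_; ∃-syntax)
open import Relation.Nullary using (¬_; Dec)

-- Inc(ω): finite strictly increasing sequences of naturals.
-- A finite subset of ω is represented canonically by its increasing
-- enumeration, so finite sets are also elements of Inc(ω).
Inc : Set
Inc = Σ (List ℕ) (Linked _<_)

FinSet : Set
FinSet = Inc

_∈ₛ_ : ℕ → FinSet → Set
x ∈ₛ F = x ∈ Σ.proj₁ F

_>ₛ_ : FinSet → ℕ → Set
F >ₛ z = ∀ x → x ∈ₛ F → z < x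

-- A finite (nonempty) subtree of Inc(ω): a finite set of nodes, each an
-- increasing sequence, containing the root and closed under initial segments.
-- (Bounded width is automatic for a finite set of nodes.)
record FinTree : Set where
  field
    nodes        : List (List ℕ)
    nodesInc     : All (Linked _<_) nodes
    hasRoot      : [] ∈ nodes
    prefixClosed : ∀ {α : List ℕ} {n : ℕ} → (α ∷ʳ n) ∈ nodes → α ∈ nodes
open FinTree public

Terminal : FinTree → List ℕ → Set
Terminal T α = α ∈ nodes T × (∀ n → ¬ ((α ∷ʳ n) ∈ nodes T))

_∈ran_ : ℕ → FinTree → Set
x ∈ran T = ∃[ α ] (α ∈ nodes T × x ∈ α)

_<ᵀ_ : FinTree → FinTree → Set
T <ᵀ U = ∀ x y → x ∈ran T → y ∈ran U → x < y

IsφTree : (FinSet → Set) → FinTree → Set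
IsφTree φ T = ∀ α → Terminal T α → ∃[ F ] (Σ.proj₁ F ⊆ α × φ F)

InfiniteφSequence : (FinSet → Set) → Set
InfiniteφSequence φ =
  Σ (ℕ → FinTree) λ T → (∀ i → IsφTree φ (T i)) × (∀ i → T i <ᵀ T (suc i))

LEM : Set₁
LEM = (P : Set) → Dec P

module Submission where

-- Argue classically (the hypothesis LEM).  If no bound z as
-- in the conclusion exists, then for every z there is a finite set F > z
-- with φ(F), and from such a choice of sets we build an infinite
-- φ-sequence, contradicting the hypothesis.
--
-- Two observations make the construction work.
--  * Every finite set F with φ(F) yields a φ-tree: the tree of all initial
--    segments of the increasing enumeration of F.  Its only terminal node is
--    the enumeration of F itself, and its range is F.
--  * Choosing F₀ > 0 and then F_{i+1} > max F_i gives F₀ < F₁ < ⋯, hence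
--    the corresponding prefix trees form an infinite φ-sequence.

open import Defs
open import Data.Nat using (ℕ; zero; suc)
open import Data.Nat.Properties using (≤-<-trans)
open import Data.List using (List; []; _∷_; _∷ʳ_; inits)
open import Data.List.Extrema.Nat using (max; xs≤max)
open import Data.List.Membership.Propositional using (_∈_)
open import Data.List.Membership.Propositional.Properties using (∈-map⁻; ∈-map⁺; []∈inits)
open import Data.List.Relation.Binary.Subset.Propositional using (_⊆_)
open import Data.List.Relation.Unary.All as All using ()
open import Data.List.Relation.Unary.Any using (here; there)
open import Data.List.Relation.Unary.Linked using (Linked; []; [-]; _∷_)
open import Data.Product using (Σ; ∃-syntax; _×_; _,_; proj₁; proj₂)
open import Data.Sum using (_⊎_; inj₁; inj₂)
open import Function using (id)
open import Relation.Binary using (Rel)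
open import Relation.Nullary using (¬_; yes; no; contradiction)
open import Relation.Binary.PropositionalEquality using (_≡_; refl)

module _ {A : Set} where

  ∈-inits-∷⁻ : ∀ {x : A} {xs α} → α ∈ inits (x ∷ xs) →
    α ≡ [] ⊎ ∃[ β ] (β ∈ inits xs × α ≡ x ∷ β)
  ∈-inits-∷⁻ (here refl) = inj₁ refl
  ∈-inits-∷⁻ {x} (there p) with ∈-map⁻ (x ∷_) p
  ... | β , β∈ , refl = inj₂ (β , β∈ , refl)

  ∈-inits-∷⁺ : ∀ {x : A} {xs β} → β ∈ inits xs → (x ∷ β) ∈ inits (x ∷ xs)
  ∈-inits-∷⁺ {x} β∈ = there (∈-map⁺ (x ∷_) β∈)

  inits-⊆ : ∀ {xs α : List A} → α ∈ inits xs → α ⊆ xs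
  inits-⊆ {[]} (here refl) ()
  inits-⊆ {x ∷ xs} α∈ y∈α with ∈-inits-∷⁻ α∈ | y∈α
  ... | inj₁ refl | ()
  ... | inj₂ (β , β∈ , refl) | here y≡x = here y≡x
  ... | inj₂ (β , β∈ , refl) | there y∈β = there (inits-⊆ β∈ y∈β)

  inits-∷ʳ⁻ : ∀ {xs α : List A} {n} → (α ∷ʳ n) ∈ inits xs → α ∈ inits xs
  inits-∷ʳ⁻ {[]} {[]} (here ())
  inits-∷ʳ⁻ {[]} {_ ∷ _} (here ())
  inits-∷ʳ⁻ {x ∷ xs} {α} p with ∈-inits-∷⁻ p
  inits-∷ʳ⁻ {x ∷ xs} {[]} p | _ = here refl
  inits-∷ʳ⁻ {x ∷ xs} {_ ∷ α} p | inj₂ (β , β∈ , refl) = ∈-inits-∷⁺ (inits-∷ʳ⁻ β∈)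

  inits-extend : ∀ {xs α : List A} → α ∈ inits xs →
    α ≡ xs ⊎ ∃[ n ] ((α ∷ʳ n) ∈ inits xs)
  inits-extend {[]} (here refl) = inj₁ refl
  inits-extend {x ∷ xs} α∈ with ∈-inits-∷⁻ α∈
  ... | inj₁ refl = inj₂ (x , ∈-inits-∷⁺ ([]∈inits xs))
  ... | inj₂ (β , β∈ , refl) with inits-extend β∈
  ...   | inj₁ refl = inj₁ refl
  ...   | inj₂ (n , β∷ʳn∈) = inj₂ (n , ∈-inits-∷⁺ β∷ʳn∈)

  module _ {ℓ} {R : Rel A ℓ} where

    Linked-∷-inits : ∀ {x ys β} → Linked R (x ∷ ys) → β ∈ inits ys → Linked R (x ∷ β)
    Linked-∷-inits {ys = []} _ (here refl) = [-]
    Linked-∷-inits {ys = y ∷ ys} (Rxy ∷ chain) β∈ with ∈-inits-∷⁻ β∈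
    ... | inj₁ refl = [-]
    ... | inj₂ (γ , γ∈ , refl) = Rxy ∷ Linked-∷-inits chain γ∈

    inits-Linked : ∀ {xs α} → Linked R xs → α ∈ inits xs → Linked R α
    inits-Linked {[]} _ (here refl) = []
    inits-Linked {x ∷ xs} chain α∈ with ∈-inits-∷⁻ α∈
    ... | inj₁ refl = []
    ... | inj₂ (β , β∈ , refl) = Linked-∷-inits chain β∈

prefixTree : FinSet → FinTree
prefixTree (xs , increasing) = record
  { nodes        = inits xs
  ; nodesInc     = All.tabulate (inits-Linked increasing)
  ; hasRoot      = []∈inits xs
  ; prefixClosed = inits-∷ʳ⁻
  }

ran-prefixTree : ∀ {x} F → x ∈ran prefixTree F → x ∈ₛ F
ran-prefixTree F (α , α∈ , x∈α) = inits-⊆ α∈ x∈α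

-- If φ(F) then the prefix tree of F is a φ-tree: its only terminal node is
-- the enumeration of F, whose range is F itself.
prefixTree-φ : (φ : FinSet → Set) (F : FinSet) → φ F → IsφTree φ (prefixTree F)
prefixTree-φ φ F φF α (α∈ , terminal) with inits-extend α∈
... | inj₁ refl = F , id , φF
... | inj₂ (n , α∷ʳn∈) = contradiction α∷ʳn∈ (terminal n)

prefixTree-< : (F G : FinSet) → G >ₛ max 0 (proj₁ F) → prefixTree F <ᵀ prefixTree G
prefixTree-< F G G>maxF x y x∈ y∈ =
  ≤-<-trans (All.lookup (xs≤max 0 (proj₁ F)) (ran-prefixTree F x∈))
            (G>maxF y (ran-prefixTree G y∈))

Unbounded : (FinSet → Set) → Set
Unbounded φ = (z : ℕ) → Σ FinSet (λ F → F >ₛ z × φ F)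

unbounded⇒sequence : (φ : FinSet → Set) → Unbounded φ → InfiniteφSequence φ
unbounded⇒sequence φ next =
  (λ i → prefixTree (set i)) ,
  (λ i → prefixTree-φ φ (set i) (proj₂ (proj₂ (next (bound i))))) ,
  (λ i → prefixTree-< (set i) (set (suc i)) (proj₁ (proj₂ (next (bound (suc i))))))
  where
  bound : ℕ → ℕ
  set : ℕ → FinSet
  set i = proj₁ (next (bound i))
  bound zero = 0
  bound (suc i) = max 0 (proj₁ (set i))

EventuallyFails : (FinSet → Set) → Set
EventuallyFails φ = ∃[ z ] (∀ (F : FinSet) → F >ₛ z → ¬ φ F)

¬eventuallyFails⇒unbounded : LEM → (φ : FinSet → Set) →
  ¬ EventuallyFails φ → Unbounded φ
¬eventuallyFails⇒unbounded lem φ ¬fails z with lem (Σ FinSet (λ F → F >ₛ z × φ F))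
... | yes witness = witness
... | no none = contradiction (z , λ F F>z φF → none (F , F>z , φF)) ¬fails

lemma2p2 : LEM → (φ : FinSet → Set) → ¬ InfiniteφSequence φ →
    ∃[ z ] (∀ (F : FinSet) → F >ₛ z → ¬ φ F)
lemma2p2 lem φ noSequence with lem (EventuallyFails φ)
... | yes fails = fails
... | no ¬fails =
  contradiction (unbounded⇒sequence φ (¬eventuallyFails⇒unbounded lem φ ¬fails)) noSequence
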